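{- Fix an integer $r\ge3$. Then $\tilde M_{r,1,\infty}$ and $\tilde B_{r,1,\infty}$ are subgroups of $\mathrm{Aut}(T_\infty)$. Moreover, $R_{r,1}:\tilde M_{r,1,\infty}\to\mathbb{Z}/2\mathbb{Z}$ is a homomorphism with kernel $\tilde B_{r,1,\infty}$.
   Context: $T_\infty$ is the infinite binary rooted tree whose nodes are finite words in $\{a,b\}$ ($w$ joined to $wa,wb$), with automorphism group $\mathrm{Aut}(T_\infty)$. For $\sigma\in\mathrm{Aut}(T_\infty)$ and a word $x$, $\mathrm{Par}(\sigma,x)\in\mathbb{Z}/2\mathbb{Z}$ is $0$ if $\sigma(xa)=\sigma(x)a$ and $1$ if $\sigma(xa)=\sigma(x)b$. $P^a_{r,1}(\sigma,x)=\mathrm{Par}(\sigma,xb)+\sum_{w\in\{a,b\}^{r-1}}\mathrm{Par}(\sigma,xaw)$, $P^b_{r,1}(\sigma,x)=\mathrm{Par}(\sigma,xa)+\sum_{w\in\{a,b\}^{r-1}}\mathrm{Par}(\sigma,xbw)$ (mod 2); $M_{r,1,\infty}$ is the set of $\sigma$ for which all these values over all nodes coincide (common value $P_{r,1}(\sigma)$), and $B_{r,1,\infty}=\{\sigma\in M_{r,1,\infty}:P_{r,1}(\sigma)=0\}$. $R_{r,1}(\sigma,x)=\mathrm{Par}(\sigma,xa)\mathrm{Par}(\sigma,xb)+\sum_{w\in\{a,b\}^{r-2}}(\mathrm{Par}(\sigma,xabw)+\mathrm{Par}(\sigma,xbbw))\in\mathbb{Z}/2\mathbb{Z}$. $\tilde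 M_{r,1,\infty}$ is the set of $\sigma\in B_{r,1,\infty}$ with $R_{r,1}(\sigma,x_1)=R_{r,1}(\sigma,x_2)$ for all nodes $x_1,x_2$; $R_{r,1}(\sigma)$ is the common value; $\tilde B_{r,1,\infty}=\{\sigma\in\tilde M_{r,1,\infty}:R_{r,1}(\sigma)=0\}$. -}

module Defs where

open import Data.Bool using (Bool; true; false; _xor_; _∧_)
open import Data.List using (List; []; _∷_; [_]; _++_; map; foldr)
open import Data.Nat using (ℕ; zero; suc; _∸_)
open import Data.Product using (Σ; _×_; _,_; proj₁; proj₂)
open import Relation.Binary.PropositionalEquality using (_≡_; refl; cong; trans; sym)
open import Function using (_⇔_)

-- Letters: false = a, true = b.  Z/2Z is modelled by Bool with _xor_ (0 = false).
Letter : Set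
Letter = Bool

-- Words in {a,b}, read left to right; the children of x are x ++ [ a ] and x ++ [ b ].
Word : Set
Word = List Letter

-- Automorphisms of the rooted binary tree T_∞: a bijection of the vertex set
-- (given with its two-sided inverse) fixing the root and mapping children to
-- children (both the map and its inverse preserve the parent/child relation).
record Aut : Set where
  field
    fun      : Word → Word
    inv      : Word → Word
    fun-inv  : ∀ x → fun (inv x) ≡ x
    inv-fun  : ∀ x → inv (fun x) ≡ x
    fun-root : fun [] ≡ []
    inv-root : inv [] ≡ []
    fun-child : ∀ x c → Σ Letter λ c′ → fun (x ++ [ c ]) ≡ fun x ++ [ c′ ]
    inv-child : ∀ x c → Σ Letter λ c′ → inv (x ++ [ c ]) ≡ inv x ++ [ c′ ]
open Aut public

-- Group structure (σ ∙ τ applies τ first, then σ).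
idAut : Aut
idAut = record
  { fun = λ x → x ; inv = λ x → x
  ; fun-inv = λ _ → refl ; inv-fun = λ _ → refl
  ; fun-root = refl ; inv-root = refl
  ; fun-child = λ x c → c , refl ; inv-child = λ x c → c , refl }

_∙_ : Aut → Aut → Aut
σ ∙ τ = record
  { fun = λ x → fun σ (fun τ x)
  ; inv = λ x → inv τ (inv σ x)
  ; fun-inv = λ x → trans (cong (fun σ) (fun-inv τ (inv σ x))) (fun-inv σ x)
  ; inv-fun = λ x → trans (cong (inv τ) (inv-fun σ (fun τ x))) (inv-fun τ x)
  ; fun-root = trans (cong (fun σ) (fun-root τ)) (fun-root σ)
  ; inv-root = trans (cong (inv τ) (inv-root σ)) (inv-root τ)
  ; fun-child = λ x c →
      let (d , p) = fun-child τ x c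
          (e , q) = fun-child σ (fun τ x) d
      in e , trans (cong (fun σ) p) q
  ; inv-child = λ x c →
      let (d , p) = inv-child σ x c
          (e , q) = inv-child τ (inv σ x) d
      in e , trans (cong (inv τ) p) q }

_⁻¹ : Aut → Aut
σ ⁻¹ = record
  { fun = inv σ ; inv = fun σ
  ; fun-inv = inv-fun σ ; inv-fun = fun-inv σ
  ; fun-root = inv-root σ ; inv-root = fun-root σ
  ; fun-child = inv-child σ ; inv-child = fun-child σ }

record IsSubgroup (H : Aut → Set) : Set where
  field
    has-id  : H idAut
    closed-∙ : ∀ σ τ → H σ → H τ → H (σ ∙ τ)
    closed-⁻¹ : ∀ σ → H σ → H (σ ⁻¹)

-- Par(σ,x) = 0 (false) iff σ(xa) = σ(x)a, and 1 (true) iff σ(xa) = σ(x)b.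
Par : Aut → Word → Bool
Par σ x = proj₁ (fun-child σ x false)

words : ℕ → List Word
words zero = [ [] ]
words (suc n) = map (false ∷_) (words n) ++ map (true ∷_) (words n)

Σ2 : ℕ → (Word → Bool) → Bool
Σ2 n f = foldr _xor_ false (map f (words n))

a b : Letter
a = false
b = true

Pa : ℕ → Aut → Word → Bool
Pa r σ x = Par σ (x ++ [ b ]) xor Σ2 (r ∸ 1) (λ w → Par σ (x ++ a ∷ w))

Pb : ℕ → Aut → Word → Bool
Pb r σ x = Par σ (x ++ [ a ]) xor Σ2 (r ∸ 1) (λ w → Par σ (x ++ b ∷ w))

M : ℕ → Aut → Set
M r σ = ∀ x y → (Pa r σ x ≡ Pa r σ y) × (Pa r σ x ≡ Pb r σ y)

-- common value P_{r,1}(σ) (meaningful on M)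
P : ℕ → Aut → Bool
P r σ = Pa r σ []

B : ℕ → Aut → Set
B r σ = M r σ × (P r σ ≡ false)

R : ℕ → Aut → Word → Bool
R r σ x = (Par σ (x ++ [ a ]) ∧ Par σ (x ++ [ b ]))
  xor Σ2 (r ∸ 2) (λ w → Par σ (x ++ a ∷ b ∷ w) xor Par σ (x ++ b ∷ b ∷ w))

M̃ : ℕ → Aut → Set
M̃ r σ = B r σ × (∀ x y → R r σ x ≡ R r σ y)

-- common value R_{r,1}(σ) (meaningful on M̃)
Rval : ℕ → Aut → Bool
Rval r σ = R r σ []

B̃ : ℕ → Aut → Set
B̃ r σ = M̃ r σ × (Rval r σ ≡ false)

-- Everything rests on the parity cocycle Par (σ ∙ τ) x = Par τ x + Par σ (τ x) and on the fact
-- that σ maps the level-n subtree below z onto the one below σ z, so a level sum of a function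
-- of σ w depends only on σ z.  Hence P^s (sibling parity plus the sum below the s-child) is a
-- cocycle twisted by the letter s, and B, where it vanishes, is a subgroup.  R sums below the
-- grandchildren z a b and z b b, which τ may send to grandchildren ending in a; inside B the
-- vanishing of P^ expresses every grandchild sum through the one ending in a, and after that a
-- truth-table identity shows that R is a cocycle, so its constant value is additive.
module Submission where

open import Defs
open import Algebra.Bundles using (CommutativeRing)
open import Data.Bool using (Bool; true; false; not; _xor_; _∧_; _∨_)
open import Data.Bool.Properties
  using ( xor-assoc; xor-comm; xor-identityʳ; xor-same; xor-inverseʳ; not-involutive
        ; not-distribˡ-xor; ∨-comm; xor-∧-commutativeRing )
open import Data.Empty using (⊥; ⊥-elim)
open import Data.List using ([]; _∷_; [_]; _++_; map; foldr)
open import Data.List.Properties using (++-assoc; ++-identityʳ; ∷ʳ-injectiveʳ; map-++; map-∘; map-cong)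
open import Data.Nat using (ℕ; zero; suc; _+_; _≤_; s≤s; _∸_)
open import Data.Product using (_×_; _,_; proj₁; proj₂)
open import Function using (_⇔_; mk⇔; id; _∘_)
open import Relation.Binary.PropositionalEquality
  using (_≡_; refl; sym; trans; cong; cong₂; subst; subst₂; module ≡-Reasoning)
open import Algebra.Solver.CommutativeMonoid
  (CommutativeRing.+-commutativeMonoid xor-∧-commutativeRing) using (solve; _⊜_; _⊕_)

open ≡-Reasoning

xor≡false⇒≡ : ∀ x y → x xor y ≡ false → x ≡ y
xor≡false⇒≡ false false _ = refl
xor≡false⇒≡ true  true  _ = refl

xor-cancelʳ : ∀ x y → (x xor y) xor y ≡ x
xor-cancelʳ x y = begin
  (x xor y) xor y ≡⟨ xor-assoc x y y ⟩
  x xor (y xor y) ≡⟨ cong (x xor_) (xor-same y) ⟩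
  x xor false     ≡⟨ xor-identityʳ x ⟩
  x               ∎

∧-xor-xor≡∨ : ∀ u v → (u ∧ v) xor (u xor v) ≡ u ∨ v
∧-xor-xor≡∨ false v = refl
∧-xor-xor≡∨ true  v = xor-inverseʳ v

∧-xor-twist : ∀ qa qb u v →
  ((qa xor u) ∧ (qb xor v)) xor ((not qa ∧ v) xor (not qb ∧ u)) ≡ (qa ∧ qb) xor (u ∨ v)
∧-xor-twist false false false false = refl
∧-xor-twist false false false true  = refl
∧-xor-twist false false true  false = refl
∧-xor-twist false false true  true  = refl
∧-xor-twist false true  false false = refl
∧-xor-twist false true  false true  = refl
∧-xor-twist false true  true  false = refl
∧-xor-twist false true  true  true  = refl
∧-xor-twist true  false false false = refl
∧-xor-twist true  false false true  = refl
∧-xor-twist true  false true  false = refl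
∧-xor-twist true  false true  true  = refl
∧-xor-twist true  true  false false = refl
∧-xor-twist true  true  false true  = refl
∧-xor-twist true  true  true  false = refl
∧-xor-twist true  true  true  true  = refl

xor-interchange : ∀ p q u v → (p xor q) xor (u xor v) ≡ (p xor u) xor (q xor v)
xor-interchange = solve 4 (λ p q u v → (p ⊕ q) ⊕ (u ⊕ v) ⊜ (p ⊕ u) ⊕ (q ⊕ v)) refl

swap-letters : ∀ {A : Set} (F : Letter → Letter → A) → (∀ u v → F u v ≡ F v u) →
               ∀ t → F t (not t) ≡ F false true
swap-letters F F-sym false = refl
swap-letters F F-sym true  = F-sym true false

foldr-xor-++ : ∀ xs ys → foldr _xor_ false (xs ++ ys) ≡ foldr _xor_ false xs xor foldr _xor_ false ys
foldr-xor-++ []       ys = refl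
foldr-xor-++ (x ∷ xs) ys = trans (cong (x xor_) (foldr-xor-++ xs ys)) (sym (xor-assoc x _ _))

Σ2-cong : ∀ n {f g : Word → Bool} → (∀ w → f w ≡ g w) → Σ2 n f ≡ Σ2 n g
Σ2-cong n f≗g = cong (foldr _xor_ false) (map-cong f≗g (words n))

Σ2-xor : ∀ n (f g : Word → Bool) → Σ2 n (λ w → f w xor g w) ≡ Σ2 n f xor Σ2 n g
Σ2-xor n f g = go (words n)
  where
  go : ∀ ws → foldr _xor_ false (map (λ w → f w xor g w) ws)
            ≡ foldr _xor_ false (map f ws) xor foldr _xor_ false (map g ws)
  go []       = refl
  go (w ∷ ws) = trans (cong ((f w xor g w) xor_) (go ws))
                      (xor-interchange (f w) (g w) _ _)

Σ2-false : ∀ n (f : Word → Bool) → (∀ w → f w ≡ false) → Σ2 n f ≡ false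
Σ2-false n f f≗false = trans (Σ2-cong n f≗false) (go (words n))
  where
  go : ∀ ws → foldr _xor_ false (map (λ _ → false) ws) ≡ false
  go []       = refl
  go (_ ∷ ws) = go ws

Σ2-suc : ∀ n (f : Word → Bool) →
         Σ2 (suc n) f ≡ Σ2 n (λ w → f (a ∷ w)) xor Σ2 n (λ w → f (b ∷ w))
Σ2-suc n f = begin
  foldr _xor_ false (map f (map (a ∷_) ws ++ map (b ∷_) ws))
    ≡⟨ cong (foldr _xor_ false) (map-++ f (map (a ∷_) ws) (map (b ∷_) ws)) ⟩
  foldr _xor_ false (map f (map (a ∷_) ws) ++ map f (map (b ∷_) ws))
    ≡⟨ foldr-xor-++ (map f (map (a ∷_) ws)) _ ⟩
  foldr _xor_ false (map f (map (a ∷_) ws)) xor foldr _xor_ false (map f (map (b ∷_) ws))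
    ≡⟨ sym (cong₂ (λ xs ys → foldr _xor_ false xs xor foldr _xor_ false ys) (map-∘ ws) (map-∘ ws)) ⟩
  Σ2 n (λ w → f (a ∷ w)) xor Σ2 n (λ w → f (b ∷ w)) ∎
  where ws = words n

fun-injective : ∀ σ {x y} → fun σ x ≡ fun σ y → x ≡ y
fun-injective σ {x} {y} eq = trans (sym (inv-fun σ x)) (trans (cong (inv σ) eq) (inv-fun σ y))

siblings-distinct : ∀ σ y {d} → fun σ (y ++ [ b ]) ≡ fun σ y ++ [ d ] →
                    fun σ (y ++ [ a ]) ≡ fun σ y ++ [ d ] → ⊥
siblings-distinct σ y σyb σya with ∷ʳ-injectiveʳ y y (fun-injective σ (trans σyb (sym σya)))
... | ()

children-differ : ∀ σ y {d p} → fun σ (y ++ [ b ]) ≡ fun σ y ++ [ d ] →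
                  fun σ (y ++ [ a ]) ≡ fun σ y ++ [ p ] → d ≡ not p
children-differ σ y {false} {true}  _   _   = refl
children-differ σ y {true}  {false} _   _   = refl
children-differ σ y {false} {false} σyb σya = ⊥-elim (siblings-distinct σ y σyb σya)
children-differ σ y {true}  {true}  σyb σya = ⊥-elim (siblings-distinct σ y σyb σya)

fun-snoc : ∀ σ y c → fun σ (y ++ [ c ]) ≡ fun σ y ++ [ c xor Par σ y ]
fun-snoc σ y false = proj₂ (fun-child σ y a)
fun-snoc σ y true  =
  subst (λ d → fun σ (y ++ [ b ]) ≡ fun σ y ++ [ d ])
        (children-differ σ y (proj₂ (fun-child σ y b)) (proj₂ (fun-child σ y a)))
        (proj₂ (fun-child σ y b))

Par-∙ : ∀ σ τ x → Par (σ ∙ τ) x ≡ Par τ x xor Par σ (fun τ x)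
Par-∙ σ τ x = ∷ʳ-injectiveʳ (fun σ (fun τ x)) _ (begin
  fun (σ ∙ τ) x ++ [ Par (σ ∙ τ) x ]         ≡⟨ sym (proj₂ (fun-child (σ ∙ τ) x a)) ⟩
  fun σ (fun τ (x ++ [ a ]))                 ≡⟨ cong (fun σ) (fun-snoc τ x a) ⟩
  fun σ (fun τ x ++ [ Par τ x ])             ≡⟨ fun-snoc σ (fun τ x) (Par τ x) ⟩
  fun σ (fun τ x) ++ [ Par τ x xor Par σ (fun τ x) ] ∎)

ParTrivial : Aut → Set
ParTrivial ρ = ∀ x → Par ρ x ≡ false

fixing-all⇒ParTrivial : ∀ ρ → (∀ x → fun ρ x ≡ x) → ParTrivial ρ
fixing-all⇒ParTrivial ρ ρ≗id x = sym (∷ʳ-injectiveʳ x x (begin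
  x ++ [ a ]                 ≡⟨ sym (ρ≗id (x ++ [ a ])) ⟩
  fun ρ (x ++ [ a ])         ≡⟨ proj₂ (fun-child ρ x a) ⟩
  fun ρ x ++ [ Par ρ x ]     ≡⟨ cong (_++ [ Par ρ x ]) (ρ≗id x) ⟩
  x ++ [ Par ρ x ]           ∎))

⁻¹∙-ParTrivial : ∀ σ → ParTrivial ((σ ⁻¹) ∙ σ)
⁻¹∙-ParTrivial σ = fixing-all⇒ParTrivial ((σ ⁻¹) ∙ σ) (inv-fun σ)

Σ2-fun-child : ∀ σ (f : Word → Bool) n z c →
  Σ2 n (λ w → f (fun σ (z ++ c ∷ w))) ≡ Σ2 n (λ w → f (fun σ z ++ (c xor Par σ z) ∷ w))

Σ2-fun-subtree : ∀ σ (f : Word → Bool) n z →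
  Σ2 n (λ w → f (fun σ (z ++ w))) ≡ Σ2 n (λ w → f (fun σ z ++ w))
Σ2-fun-subtree σ f zero z rewrite ++-identityʳ z | ++-identityʳ (fun σ z) = refl
Σ2-fun-subtree σ f (suc n) z = begin
  Σ2 (suc n) (λ w → f (fun σ (z ++ w)))
    ≡⟨ Σ2-suc n _ ⟩
  Σ2 n (λ w → f (fun σ (z ++ a ∷ w))) xor Σ2 n (λ w → f (fun σ (z ++ b ∷ w)))
    ≡⟨ cong₂ _xor_ (Σ2-fun-child σ f n z a) (Σ2-fun-child σ f n z b) ⟩
  below (Par σ z) xor below (not (Par σ z))
    ≡⟨ swap-letters (λ c c′ → below c xor below c′) (λ c c′ → xor-comm (below c) (below c′)) (Par σ z) ⟩
  below a xor below b
    ≡⟨ sym (Σ2-suc n _) ⟩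
  Σ2 (suc n) (λ w → f (fun σ z ++ w)) ∎
  where
  below : Letter → Bool
  below c = Σ2 n (λ w → f (fun σ z ++ c ∷ w))

Σ2-fun-child σ f n z c = begin
  Σ2 n (λ w → f (fun σ (z ++ c ∷ w)))
    ≡⟨ Σ2-cong n (λ w → cong (f ∘ fun σ) (sym (++-assoc z [ c ] w))) ⟩
  Σ2 n (λ w → f (fun σ ((z ++ [ c ]) ++ w)))
    ≡⟨ Σ2-fun-subtree σ f n (z ++ [ c ]) ⟩
  Σ2 n (λ w → f (fun σ (z ++ [ c ]) ++ w))
    ≡⟨ Σ2-cong n (λ w → cong f (trans (cong (_++ w) (fun-snoc σ z c)) (++-assoc (fun σ z) _ w))) ⟩
  Σ2 n (λ w → f (fun σ z ++ (c xor Par σ z) ∷ w)) ∎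

-- P^ r σ s x is P^s_{r,1}(σ,x); P^ r σ a and P^ r σ b unfold to Pa r σ and Pb r σ.

P^ : ℕ → Aut → Letter → Word → Bool
P^ r σ s x = Par σ (x ++ [ not s ]) xor Σ2 (r ∸ 1) (λ w → Par σ (x ++ s ∷ w))

B⇒P^≡false : ∀ r σ → B r σ → ∀ s x → P^ r σ s x ≡ false
B⇒P^≡false r σ (m , P≡false) false x = trans (sym (proj₁ (m [] x))) P≡false
B⇒P^≡false r σ (m , P≡false) true  x = trans (sym (proj₂ (m [] x))) P≡false

P^≡false⇒B : ∀ r σ → (∀ s x → P^ r σ s x ≡ false) → B r σ
P^≡false⇒B r σ P^≡false =
  (λ x y → trans (P^≡false a x) (sym (P^≡false a y)) , trans (P^≡false a x) (sym (P^≡false b y)))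
  , P^≡false a []

P^-trivial : ∀ r ρ → ParTrivial ρ → ∀ s x → P^ r ρ s x ≡ false
P^-trivial r ρ triv s x =
  cong₂ _xor_ (triv _) (Σ2-false (r ∸ 1) _ (λ w → triv _))

P^-∙ : ∀ r σ τ s x → P^ r (σ ∙ τ) s x ≡ P^ r τ s x xor P^ r σ (s xor Par τ x) (fun τ x)
P^-∙ r σ τ s x = begin
  Par (σ ∙ τ) (x ++ [ not s ]) xor Σ2 m (λ w → Par (σ ∙ τ) (x ++ s ∷ w))
    ≡⟨ cong₂ _xor_ sibling below ⟩
  (Par τ (x ++ [ not s ]) xor Par σ (y ++ [ not s′ ]))
    xor (Σ2 m (λ w → Par τ (x ++ s ∷ w)) xor Σ2 m (λ w → Par σ (y ++ s′ ∷ w)))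
    ≡⟨ xor-interchange (Par τ (x ++ [ not s ])) _ (Σ2 m (λ w → Par τ (x ++ s ∷ w))) _ ⟩
  P^ r τ s x xor P^ r σ s′ y ∎
  where
  m = r ∸ 1
  y = fun τ x
  s′ = s xor Par τ x
  sibling : Par (σ ∙ τ) (x ++ [ not s ]) ≡ Par τ (x ++ [ not s ]) xor Par σ (y ++ [ not s′ ])
  sibling = begin
    Par (σ ∙ τ) (x ++ [ not s ])                          ≡⟨ Par-∙ σ τ _ ⟩
    Par τ (x ++ [ not s ]) xor Par σ (fun τ (x ++ [ not s ]))
      ≡⟨ cong (λ z → Par τ (x ++ [ not s ]) xor Par σ z) (fun-snoc τ x (not s)) ⟩
    Par τ (x ++ [ not s ]) xor Par σ (y ++ [ not s xor Par τ x ])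
      ≡⟨ cong (λ c → Par τ (x ++ [ not s ]) xor Par σ (y ++ [ c ])) (sym (not-distribˡ-xor s _)) ⟩
    Par τ (x ++ [ not s ]) xor Par σ (y ++ [ not s′ ]) ∎
  below : Σ2 m (λ w → Par (σ ∙ τ) (x ++ s ∷ w))
        ≡ Σ2 m (λ w → Par τ (x ++ s ∷ w)) xor Σ2 m (λ w → Par σ (y ++ s′ ∷ w))
  below = begin
    Σ2 m (λ w → Par (σ ∙ τ) (x ++ s ∷ w))                         ≡⟨ Σ2-cong m (λ w → Par-∙ σ τ _) ⟩
    Σ2 m (λ w → Par τ (x ++ s ∷ w) xor Par σ (fun τ (x ++ s ∷ w))) ≡⟨ Σ2-xor m _ _ ⟩
    Σ2 m (λ w → Par τ (x ++ s ∷ w)) xor Σ2 m (λ w → Par σ (fun τ (x ++ s ∷ w)))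
      ≡⟨ cong (Σ2 m (λ w → Par τ (x ++ s ∷ w)) xor_) (Σ2-fun-child τ (Par σ) m x s) ⟩
    Σ2 m (λ w → Par τ (x ++ s ∷ w)) xor Σ2 m (λ w → Par σ (y ++ s′ ∷ w)) ∎

B-∙ : ∀ r σ τ → B r σ → B r τ → B r (σ ∙ τ)
B-∙ r σ τ Bσ Bτ = P^≡false⇒B r (σ ∙ τ) λ s x → begin
  P^ r (σ ∙ τ) s x                                          ≡⟨ P^-∙ r σ τ s x ⟩
  P^ r τ s x xor P^ r σ (s xor Par τ x) (fun τ x)
    ≡⟨ cong₂ _xor_ (B⇒P^≡false r τ Bτ s x) (B⇒P^≡false r σ Bσ _ _) ⟩
  false                                                     ∎

-- Applied to σ⁻¹ ∙ σ, whose parities vanish, the cocycle identity gives P^ r σ⁻¹ at the node σ x.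
B-⁻¹ : ∀ r σ → B r σ → B r (σ ⁻¹)
B-⁻¹ r σ Bσ = P^≡false⇒B r (σ ⁻¹) λ s y →
  subst₂ (λ s′ y′ → P^ r (σ ⁻¹) s′ y′ ≡ false)
         (xor-cancelʳ s (Par σ (inv σ y))) (fun-inv σ y) (at-image (s xor Par σ (inv σ y)) (inv σ y))
  where
  at-image : ∀ s x → P^ r (σ ⁻¹) (s xor Par σ x) (fun σ x) ≡ false
  at-image s x = sym (begin
    false                                                ≡⟨ sym (P^-trivial r ((σ ⁻¹) ∙ σ) (⁻¹∙-ParTrivial σ) s x) ⟩
    P^ r ((σ ⁻¹) ∙ σ) s x                                ≡⟨ P^-∙ r (σ ⁻¹) σ s x ⟩
    P^ r σ s x xor P^ r (σ ⁻¹) (s xor Par σ x) (fun σ x)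
      ≡⟨ cong (_xor P^ r (σ ⁻¹) (s xor Par σ x) (fun σ x)) (B⇒P^≡false r σ Bσ s x) ⟩
    P^ r (σ ⁻¹) (s xor Par σ x) (fun σ x)                ∎)

grandchildSum : Aut → ℕ → Word → Letter → Letter → Bool
grandchildSum σ n y c d = Σ2 n (λ w → Par σ (y ++ c ∷ d ∷ w))

-- The level-(n+1) sum below y c is the sum of the two grandchild sums, so P^ (2 + n) σ c y ≡ false relates them.
grandchildSum-split : ∀ n σ → B (2 + n) σ → ∀ y c d →
  grandchildSum σ n y c d ≡ grandchildSum σ n y c a xor (d ∧ Par σ (y ++ [ not c ]))
grandchildSum-split n σ Bσ y c false = sym (xor-identityʳ _)
grandchildSum-split n σ Bσ y c true  = sym (xor≡false⇒≡ _ _ (begin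
  (S a xor p) xor S b   ≡⟨ solve 3 (λ u v q → (u ⊕ q) ⊕ v ⊜ q ⊕ (u ⊕ v)) refl (S a) (S b) p ⟩
  p xor (S a xor S b)   ≡⟨ cong (p xor_) (sym (Σ2-suc n (λ w → Par σ (y ++ c ∷ w)))) ⟩
  P^ (2 + n) σ c y      ≡⟨ B⇒P^≡false (2 + n) σ Bσ c y ⟩
  false                 ∎))
  where
  S : Letter → Bool
  S = grandchildSum σ n y c
  p = Par σ (y ++ [ not c ])

grandchildSum-∙ : ∀ n σ τ x c d →
  Σ2 n (λ w → Par σ (fun τ (x ++ c ∷ d ∷ w)))
    ≡ grandchildSum σ n (fun τ x) (c xor Par τ x) (d xor Par τ (x ++ [ c ]))
grandchildSum-∙ n σ τ x c d = begin
  Σ2 n (λ w → Par σ (fun τ (x ++ c ∷ d ∷ w)))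
    ≡⟨ Σ2-cong n (λ w → cong (Par σ ∘ fun τ) (sym (++-assoc x [ c ] (d ∷ w)))) ⟩
  Σ2 n (λ w → Par σ (fun τ ((x ++ [ c ]) ++ d ∷ w)))
    ≡⟨ Σ2-fun-child τ (Par σ) n (x ++ [ c ]) d ⟩
  Σ2 n (λ w → Par σ (fun τ (x ++ [ c ]) ++ d′ ∷ w))
    ≡⟨ Σ2-cong n (λ w → cong (Par σ) (trans (cong (_++ d′ ∷ w) (fun-snoc τ x c))
                                            (++-assoc (fun τ x) [ c xor Par τ x ] (d′ ∷ w)))) ⟩
  grandchildSum σ n (fun τ x) (c xor Par τ x) d′ ∎
  where d′ = d xor Par τ (x ++ [ c ])

R-trivial : ∀ r ρ → ParTrivial ρ → ∀ x → R r ρ x ≡ false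
R-trivial r ρ triv x =
  cong₂ _xor_ (cong₂ _∧_ (triv _) (triv _)) (Σ2-false (r ∸ 2) _ (λ w → cong₂ _xor_ (triv _) (triv _)))

R-normal : ∀ n σ → B (2 + n) σ → ∀ y →
  R (2 + n) σ y ≡ (Par σ (y ++ [ a ]) ∨ Par σ (y ++ [ b ]))
                    xor (grandchildSum σ n y a a xor grandchildSum σ n y b a)
R-normal n σ Bσ y = begin
  (pa ∧ pb) xor Σ2 n (λ w → Par σ (y ++ a ∷ b ∷ w) xor Par σ (y ++ b ∷ b ∷ w))
    ≡⟨ cong ((pa ∧ pb) xor_) (Σ2-xor n _ _) ⟩
  (pa ∧ pb) xor (S a b xor S b b)
    ≡⟨ cong ((pa ∧ pb) xor_) (cong₂ _xor_ (split a b) (split b b)) ⟩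
  (pa ∧ pb) xor ((S a a xor pb) xor (S b a xor pa))
    ≡⟨ solve 5 (λ k u v s t → k ⊕ ((s ⊕ v) ⊕ (t ⊕ u)) ⊜ (k ⊕ (u ⊕ v)) ⊕ (s ⊕ t)) refl
               (pa ∧ pb) pa pb (S a a) (S b a) ⟩
  ((pa ∧ pb) xor (pa xor pb)) xor (S a a xor S b a)
    ≡⟨ cong (_xor (S a a xor S b a)) (∧-xor-xor≡∨ pa pb) ⟩
  (pa ∨ pb) xor (S a a xor S b a) ∎
  where
  pa = Par σ (y ++ [ a ])
  pb = Par σ (y ++ [ b ])
  S = grandchildSum σ n y
  split = grandchildSum-split n σ Bσ y

R-∙-expand : ∀ n σ τ x →
  let y = fun τ x; t = Par τ x; qa = Par τ (x ++ [ a ]); qb = Par τ (x ++ [ b ]) in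
  R (2 + n) (σ ∙ τ) x
    ≡ ((qa xor Par σ (y ++ [ t ])) ∧ (qb xor Par σ (y ++ [ not t ])))
      xor (Σ2 n (λ w → Par τ (x ++ a ∷ b ∷ w) xor Par τ (x ++ b ∷ b ∷ w))
           xor (grandchildSum σ n y t (not qa) xor grandchildSum σ n y (not t) (not qb)))
R-∙-expand n σ τ x = cong₂ _xor_ (cong₂ _∧_ (child a) (child b)) (begin
  Σ2 n (λ w → Par (σ ∙ τ) (x ++ a ∷ b ∷ w) xor Par (σ ∙ τ) (x ++ b ∷ b ∷ w))
    ≡⟨ Σ2-cong n (λ w → cong₂ _xor_ (Par-∙ σ τ _) (Par-∙ σ τ _)) ⟩
  Σ2 n (λ w → (τ-ab w xor σ-ab w) xor (τ-bb w xor σ-bb w))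
    ≡⟨ Σ2-cong n (λ w → xor-interchange (τ-ab w) (σ-ab w) (τ-bb w) (σ-bb w)) ⟩
  Σ2 n (λ w → (τ-ab w xor τ-bb w) xor (σ-ab w xor σ-bb w))
    ≡⟨ Σ2-xor n _ _ ⟩
  Σ2 n (λ w → τ-ab w xor τ-bb w) xor Σ2 n (λ w → σ-ab w xor σ-bb w)
    ≡⟨ cong (Σ2 n (λ w → τ-ab w xor τ-bb w) xor_)
            (trans (Σ2-xor n σ-ab σ-bb)
                   (cong₂ _xor_ (grandchildSum-∙ n σ τ x a b) (grandchildSum-∙ n σ τ x b b))) ⟩
  Σ2 n (λ w → τ-ab w xor τ-bb w)
    xor (grandchildSum σ n (fun τ x) (Par τ x) (not (Par τ (x ++ [ a ])))
         xor grandchildSum σ n (fun τ x) (not (Par τ x)) (not (Par τ (x ++ [ b ])))) ∎)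
  where
  child : ∀ c → Par (σ ∙ τ) (x ++ [ c ])
                ≡ Par τ (x ++ [ c ]) xor Par σ (fun τ x ++ [ c xor Par τ x ])
  child c = trans (Par-∙ σ τ _) (cong (λ z → Par τ (x ++ [ c ]) xor Par σ z) (fun-snoc τ x c))
  τ-ab τ-bb σ-ab σ-bb : Word → Bool
  τ-ab w = Par τ (x ++ a ∷ b ∷ w)
  τ-bb w = Par τ (x ++ b ∷ b ∷ w)
  σ-ab w = Par σ (fun τ (x ++ a ∷ b ∷ w))
  σ-bb w = Par σ (fun τ (x ++ b ∷ b ∷ w))

R-∙ : ∀ n σ τ → B (2 + n) σ → ∀ x → R (2 + n) (σ ∙ τ) x ≡ R (2 + n) τ x xor R (2 + n) σ (fun τ x)
R-∙ n σ τ Bσ x = begin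
  R (2 + n) (σ ∙ τ) x
    ≡⟨ R-∙-expand n σ τ x ⟩
  cross xor (sq xor (S t (not qa) xor S (not t) (not qb)))
    ≡⟨ cong (λ e → cross xor (sq xor e)) (cong₂ _xor_ (split t (not qa)) split-not-t) ⟩
  cross xor (sq xor ((S t a xor (not qa ∧ v)) xor (S (not t) a xor (not qb ∧ u))))
    ≡⟨ solve 6 (λ k s e₁ e₂ f₁ f₂ → k ⊕ (s ⊕ ((e₁ ⊕ f₁) ⊕ (e₂ ⊕ f₂))) ⊜ (k ⊕ (f₁ ⊕ f₂)) ⊕ (s ⊕ (e₁ ⊕ e₂)))
               refl cross sq (S t a) (S (not t) a) (not qa ∧ v) (not qb ∧ u) ⟩
  (cross xor ((not qa ∧ v) xor (not qb ∧ u))) xor (sq xor (S t a xor S (not t) a))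
    ≡⟨ cong (_xor (sq xor (S t a xor S (not t) a))) (∧-xor-twist qa qb u v) ⟩
  ((qa ∧ qb) xor (u ∨ v)) xor (sq xor (S t a xor S (not t) a))
    ≡⟨ xor-interchange (qa ∧ qb) (u ∨ v) sq _ ⟩
  R (2 + n) τ x xor F t (not t)
    ≡⟨ cong (R (2 + n) τ x xor_) (swap-letters F F-sym t) ⟩
  R (2 + n) τ x xor F a b
    ≡⟨ cong (R (2 + n) τ x xor_) (sym (R-normal n σ Bσ y)) ⟩
  R (2 + n) τ x xor R (2 + n) σ y ∎
  where
  y = fun τ x
  t = Par τ x
  qa = Par τ (x ++ [ a ])
  qb = Par τ (x ++ [ b ])
  sq = Σ2 n (λ w → Par τ (x ++ a ∷ b ∷ w) xor Par τ (x ++ b ∷ b ∷ w))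
  u = Par σ (y ++ [ t ])
  v = Par σ (y ++ [ not t ])
  cross = (qa xor u) ∧ (qb xor v)
  S = grandchildSum σ n y
  split = grandchildSum-split n σ Bσ y
  split-not-t : S (not t) (not qb) ≡ S (not t) a xor (not qb ∧ u)
  split-not-t = trans (split (not t) (not qb))
                      (cong (λ c → S (not t) a xor (not qb ∧ Par σ (y ++ [ c ]))) (not-involutive t))
  F : Letter → Letter → Bool
  F c c′ = (Par σ (y ++ [ c ]) ∨ Par σ (y ++ [ c′ ])) xor (S c a xor S c′ a)
  F-sym : ∀ c c′ → F c c′ ≡ F c′ c
  F-sym c c′ = cong₂ _xor_ (∨-comm (Par σ (y ++ [ c ])) _) (xor-comm (S c a) (S c′ a))

R-⁻¹ : ∀ n σ → B (2 + n) σ → ∀ y → R (2 + n) (σ ⁻¹) y ≡ R (2 + n) σ (inv σ y)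
R-⁻¹ n σ Bσ y = subst (λ z → R (2 + n) (σ ⁻¹) z ≡ R (2 + n) σ x) (fun-inv σ y) (sym (xor≡false⇒≡ _ _ (begin
  R (2 + n) σ x xor R (2 + n) (σ ⁻¹) (fun σ x) ≡⟨ sym (R-∙ n (σ ⁻¹) σ (B-⁻¹ (2 + n) σ Bσ) x) ⟩
  R (2 + n) ((σ ⁻¹) ∙ σ) x                     ≡⟨ R-trivial (2 + n) ((σ ⁻¹) ∙ σ) (⁻¹∙-ParTrivial σ) x ⟩
  false                                        ∎)))
  where x = inv σ y

idAut-ParTrivial : ParTrivial idAut
idAut-ParTrivial x = refl

M̃-isSubgroup : ∀ n → IsSubgroup (M̃ (2 + n))
M̃-isSubgroup n = record { has-id = has-id ; closed-∙ = closed-∙ ; closed-⁻¹ = closed-⁻¹ }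
  where
  r = 2 + n
  has-id : M̃ r idAut
  has-id = P^≡false⇒B r idAut (P^-trivial r idAut idAut-ParTrivial)
         , λ x y → trans (R-trivial r idAut idAut-ParTrivial x) (sym (R-trivial r idAut idAut-ParTrivial y))
  closed-∙ : ∀ σ τ → M̃ r σ → M̃ r τ → M̃ r (σ ∙ τ)
  closed-∙ σ τ (Bσ , Rσ-const) (Bτ , Rτ-const) = B-∙ r σ τ Bσ Bτ , λ x y → begin
    R r (σ ∙ τ) x                   ≡⟨ R-∙ n σ τ Bσ x ⟩
    R r τ x xor R r σ (fun τ x)     ≡⟨ cong₂ _xor_ (Rτ-const x y) (Rσ-const _ _) ⟩
    R r τ y xor R r σ (fun τ y)     ≡⟨ sym (R-∙ n σ τ Bσ y) ⟩
    R r (σ ∙ τ) y                   ∎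
  closed-⁻¹ : ∀ σ → M̃ r σ → M̃ r (σ ⁻¹)
  closed-⁻¹ σ (Bσ , Rσ-const) = B-⁻¹ r σ Bσ , λ x y →
    trans (R-⁻¹ n σ Bσ x) (trans (Rσ-const _ _) (sym (R-⁻¹ n σ Bσ y)))

Rval-∙ : ∀ n σ τ → M̃ (2 + n) σ → M̃ (2 + n) τ → Rval (2 + n) (σ ∙ τ) ≡ Rval (2 + n) σ xor Rval (2 + n) τ
Rval-∙ n σ τ (Bσ , Rσ-const) _ = begin
  R r (σ ∙ τ) []                ≡⟨ R-∙ n σ τ Bσ [] ⟩
  R r τ [] xor R r σ (fun τ []) ≡⟨ cong (R r τ [] xor_) (Rσ-const _ []) ⟩
  R r τ [] xor R r σ []         ≡⟨ xor-comm (R r τ []) _ ⟩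
  R r σ [] xor R r τ []         ∎
  where r = 2 + n

kernel-isSubgroup : ∀ {H : Aut → Set} (φ : Aut → Bool) → IsSubgroup H →
  (∀ σ τ → H σ → H τ → φ (σ ∙ τ) ≡ φ σ xor φ τ) → φ idAut ≡ false →
  (∀ σ → H σ → φ (σ ⁻¹) ≡ φ σ) → IsSubgroup (λ σ → H σ × φ σ ≡ false)
kernel-isSubgroup φ H-sub φ-∙ φ-id φ-⁻¹ = record
  { has-id = has-id , φ-id
  ; closed-∙ = λ σ τ (Hσ , φσ≡false) (Hτ , φτ≡false) →
      closed-∙ σ τ Hσ Hτ , trans (φ-∙ σ τ Hσ Hτ) (cong₂ _xor_ φσ≡false φτ≡false)
  ; closed-⁻¹ = λ σ (Hσ , φσ≡false) → closed-⁻¹ σ Hσ , trans (φ-⁻¹ σ Hσ) φσ≡false }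
  where open IsSubgroup H-sub

-- The argument only needs r ≥ 2.
theorem5p4 : (r : ℕ) → 3 ≤ r →
    IsSubgroup (M̃ r) × IsSubgroup (B̃ r)
    × (∀ σ τ → M̃ r σ → M̃ r τ → Rval r (σ ∙ τ) ≡ Rval r σ xor Rval r τ)
    × (∀ σ → B̃ r σ ⇔ (M̃ r σ × Rval r σ ≡ false))
theorem5p4 (suc (suc n)) _ =
    M̃-isSubgroup n
  , kernel-isSubgroup (Rval (2 + n)) (M̃-isSubgroup n) (Rval-∙ n)
      (R-trivial (2 + n) idAut idAut-ParTrivial [])
      (λ σ (Bσ , Rσ-const) → trans (R-⁻¹ n σ Bσ []) (Rσ-const _ []))
  , Rval-∙ n
  , λ σ → mk⇔ id id
theorem5p4 (suc zero) (s≤s ())
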